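{- Let $n$ and $b_m$ be positive integers with $b_m\leq n/2$, and let $w\in S_n$ be the layered permutation $w = w(1,\dots,1,b_m)$ (with $n-b_m$ blocks of size $1$), i.e. $w = 1\,2\,\cdots\,(n-b_m)\; n\,(n-1)\,\cdots\,(n-b_m+1)$ in one-line notation. For any subset $S\subseteq D(w)$, there exists a diagram $C\subseteq[n]\times[n]$ satisfying $C\leq D(w)$ and $C\cap D(w) = S$.
   Context: A diagram is a subset $D\subseteq[n]\times[n]$, viewed as boxes in an $n\times n$ grid with $(i,j)$ in row $i$ and column $j$; write $D = (D_1,\dots,D_n)$ where $D_j = \{i\in[n] : (i,j)\in D\}$. The Rothe diagram of $w\in S_n$ is $D(w) = \{(i,j)\in[n]\times[n] : i< w^{ -1}(j) \text{ and } j< w(i)\}$. For finite sets $A = \{a_1<\dots<a_s\}$ and $B=\{b_1<\dots<b_s\}$ of the same size, write $A\leq B$ if $a_i\leq b_i$ for all $i$ (sets of different sizes are incomparable). For diagrams $C = (C_1,\dots,C_n)$, $D=(D_1,\dots,D_n)$, write $C\leq D$ if $C_j\leq D_j$ for all $j$. -}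

module Defs where

open import Data.Nat using (ℕ; zero; suc; _+_; _*_; _∸_; _≤_; _<_; _<?_; z≤n; s≤s)
open import Data.Nat.Properties
open import Data.Fin using (Fin; toℕ; fromℕ<)
open import Data.Fin.Properties using (toℕ-injective; toℕ-fromℕ<)
open import Data.Fin.Permutation using (Permutation′; permutation; _⟨$⟩ʳ_; _⟨$⟩ˡ_)
open import Data.Bool using (Bool; true; false; T)
open import Data.List using (List; filter; allFin)
open import Data.List.Relation.Binary.Pointwise using (Pointwise)
open import Data.Product using (_×_; _,_)
open import Relation.Nullary using (yes; no; does)
open import Relation.Binary.PropositionalEquality
open import Relation.Unary using (Decidable)

-- Conventions: [n] is modelled by Fin n (0-indexed: Fin value r stands
-- for r+1).  A permutation w ∈ S_n is a Permutation′ n, acting by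
-- w ⟨$⟩ʳ i, with inverse w ⟨$⟩ˡ j.

-- A diagram D ⊆ [n] × [n]: a Boolean-valued indicator on (row, column).
Diagram : ℕ → Set
Diagram n = Fin n → Fin n → Bool

_∋_ : ∀ {n} → Diagram n → Fin n × Fin n → Set
D ∋ (i , j) = T (D i j)

rothe : ∀ {n} → Permutation′ n → Diagram n
rothe w i j = does (toℕ i <? toℕ (w ⟨$⟩ˡ j)) Data.Bool.∧ does (toℕ j <? toℕ (w ⟨$⟩ʳ i))

column : ∀ {n} → Diagram n → Fin n → List (Fin n)
column {n} D j = filter (λ i → T? (D i j)) (allFin n)
  where
  T? : (b : Bool) → Relation.Nullary.Dec (T b)
  T? = Data.Bool.T?

-- A ≤ B for finite sets given as increasing lists: same size and
-- a_i ≤ b_i for every i (Pointwise forces equal length).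
_≤ˢ_ : ∀ {n} → List (Fin n) → List (Fin n) → Set
A ≤ˢ B = Pointwise (λ a b → toℕ a ≤ toℕ b) A B

_≤ᴰ_ : ∀ {n} → Diagram n → Diagram n → Set
C ≤ᴰ D = ∀ j → column C j ≤ˢ column D j

-- The layered permutation w(1,…,1,b) ∈ S_n (n - b blocks of size 1):
-- 0-indexed, w(i) = i for i < n - b, and w(i) = (n - b) + (n - 1 - i)
-- for i ≥ n - b (reversal of the last b positions).

wℕ : ℕ → ℕ → ℕ → ℕ
wℕ k n i with i <? k
... | yes _ = i
... | no  _ = k + (n ∸ suc i)

private
  lem-sub : ∀ c t → t < c → c ∸ suc (c ∸ suc t) ≡ t
  lem-sub (suc c) t (s≤s t≤c) = m∸[m∸n]≡n t≤c

  split-n : ∀ k n i → k ≤ i → i < n →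
            n ∸ suc i ≡ (n ∸ k) ∸ suc (i ∸ k)
  split-n k n i k≤i i<n = begin
      n ∸ suc i
    ≡⟨ cong₂ _∸_ (sym (m+[n∸m]≡n k≤n)) (cong suc (sym (m+[n∸m]≡n k≤i))) ⟩
      (k + (n ∸ k)) ∸ suc (k + (i ∸ k))
    ≡⟨ cong ((k + (n ∸ k)) ∸_) (sym (+-suc k (i ∸ k))) ⟩
      (k + (n ∸ k)) ∸ (k + suc (i ∸ k))
    ≡⟨ [m+n]∸[m+o]≡n∸o k (n ∸ k) (suc (i ∸ k)) ⟩
      (n ∸ k) ∸ suc (i ∸ k) ∎
    where
    open ≡-Reasoning
    k≤n = ≤-trans k≤i (<⇒≤ i<n)

  t<c : ∀ k n i → k ≤ i → i < n → i ∸ k < n ∸ k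
  t<c k n i k≤i i<n = ∸-monoˡ-< i<n k≤i

  wℕ-< : ∀ k n i → i < n → wℕ k n i < n
  wℕ-< k n i i<n with i <? k
  ... | yes _ = i<n
  ... | no i≮k = begin-strict
        k + (n ∸ suc i)
      ≡⟨ cong (k +_) (split-n k n i (≮⇒≥ i≮k) i<n) ⟩
        k + ((n ∸ k) ∸ suc (i ∸ k))
      <⟨ +-monoʳ-< k (∸-monoʳ-< {n ∸ k} (s≤s z≤n) (t<c k n i (≮⇒≥ i≮k) i<n)) ⟩
        k + ((n ∸ k) ∸ 0)
      ≡⟨ m+[n∸m]≡n (≤-trans (≮⇒≥ i≮k) (<⇒≤ i<n)) ⟩
        n ∎
    where open ≤-Reasoning

  wℕ-inv : ∀ k n i → i < n → wℕ k n (wℕ k n i) ≡ i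
  wℕ-inv k n i i<n with i <? k
  ... | yes i<k with i <? k
  ...   | yes _ = refl
  ...   | no i≮k = ⊥-elim (i≮k i<k)
    where open import Data.Empty using (⊥-elim)
  wℕ-inv k n i i<n | no i≮k with k + (n ∸ suc i) <? k
  ... | yes j<k = ⊥-elim (m+n≮m k _ j<k)
    where open import Data.Empty using (⊥-elim)
  ... | no _ = begin
        k + (n ∸ suc (k + (n ∸ suc i)))
      ≡⟨ cong (λ x → k + (n ∸ suc (k + x))) e ⟩
        k + (n ∸ suc (k + (c ∸ suc t)))
      ≡⟨ cong (k +_) (split-n k n (k + (c ∸ suc t)) (m≤m+n k _) j<n) ⟩
        k + (c ∸ suc ((k + (c ∸ suc t)) ∸ k))
      ≡⟨ cong (λ x → k + (c ∸ suc x)) (m+n∸m≡n k (c ∸ suc t)) ⟩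
        k + (c ∸ suc (c ∸ suc t))
      ≡⟨ cong (k +_) (lem-sub c t (t<c k n i k≤i i<n)) ⟩
        k + t
      ≡⟨ m+[n∸m]≡n k≤i ⟩
        i ∎
    where
    open ≡-Reasoning
    k≤i = ≮⇒≥ i≮k
    c = n ∸ k
    t = i ∸ k
    e = split-n k n i k≤i i<n
    j<n : k + (c ∸ suc t) < n
    j<n = subst (_< n) (cong (k +_) e) (wℕ-<′)
      where
      wℕ-<′ : k + (n ∸ suc i) < n
      wℕ-<′ with wℕ-< k n i i<n
      ... | p with i <? k
      ...   | yes i<k = ⊥-elim (i≮k i<k)
        where open import Data.Empty using (⊥-elim)
      ...   | no _ = p

layeredFun : (n b : ℕ) → Fin n → Fin n
layeredFun n b i = fromℕ< (wℕ-< (n ∸ b) n (toℕ i) (Data.Fin.Properties.toℕ<n i))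

private
  layered-inv : ∀ n b i → layeredFun n b (layeredFun n b i) ≡ i
  layered-inv n b i = toℕ-injective (begin
      toℕ (layeredFun n b (layeredFun n b i))
    ≡⟨ toℕ-fromℕ< _ ⟩
      wℕ (n ∸ b) n (toℕ (layeredFun n b i))
    ≡⟨ cong (wℕ (n ∸ b) n) (toℕ-fromℕ< _) ⟩
      wℕ (n ∸ b) n (wℕ (n ∸ b) n (toℕ i))
    ≡⟨ wℕ-inv (n ∸ b) n (toℕ i) (Data.Fin.Properties.toℕ<n i) ⟩
      toℕ i ∎)
    where open ≡-Reasoning

layered : (n b : ℕ) → Permutation′ n
layered n b = permutation (layeredFun n b) (layeredFun n b)
  (λ i → layered-inv n b i) (λ i → layered-inv n b i)

_∩ᴰ_ : ∀ {n} → Diagram n → Diagram n → Diagram n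
(C ∩ᴰ D) i j = C i j Data.Bool.∧ D i j

_⊆ᴰ_ : ∀ {n} → Diagram n → Diagram n → Set
S ⊆ᴰ D = ∀ i j → S ∋ (i , j) → D ∋ (i , j)

_≡ᴰ_ : ∀ {n} → Diagram n → Diagram n → Set
C ≡ᴰ D = ∀ i j → C i j ≡ D i j

{-# OPTIONS --safe #-}
module Submission where

-- Write k = n - b. Column j of D(w) is a run of rows [k, U j) with U j ≤ n, so the rows
-- 0 … k-1 of D(w) are empty; as b ≤ k, rows 0 … b-1 are free. Given S ⊆ D(w), let C consist
-- of S together with every box (r + k, j) of D(w) \ S moved up to (r, j). Then C ∩ D(w) = S,
-- and column j of C has U j - k boxes, as many as D(w)_j, all in rows below U j. A strictly
-- increasing list of m numbers below U is entrywise at most the last m numbers below U,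
-- which here form exactly D(w)_j; hence C ≤ D(w).

open import Defs
open import Data.Nat using (ℕ; _*_; _≤_)
open import Data.Product using (Σ; _×_)

open import Data.Bool using (Bool; true; false; T; _∧_; _∨_; not)
open import Data.Bool.Properties using (T-∧; T-∨; ∧-identityʳ; ∧-zeroʳ; ∨-identityʳ)
open import Data.Empty using (⊥-elim)
open import Data.Fin using (Fin; toℕ; fromℕ<)
open import Data.Fin.Permutation using (Permutation′; _⟨$⟩ʳ_; _⟨$⟩ˡ_)
open import Data.Fin.Properties using (toℕ-fromℕ<; fromℕ<-toℕ; toℕ<n)
open import Data.List using (List; []; _∷_; _++_; length; map; filterᵇ; tabulate; allFin)
open import Data.List.Properties
  using (length-++; ++-identityʳ; filter-++; filter-all; filter-none; tabulate-cong; map-tabulate)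
open import Data.List.Relation.Binary.Pointwise using (Pointwise; []; _∷_; map⁻)
open import Data.List.Relation.Unary.All using (All; []; _∷_)
open import Data.Nat using (zero; suc; _+_; _∸_; _<_; _<?_; z<s; s≤s)
open import Data.Nat.Properties
open import Data.Product using (_,_; proj₁; proj₂)
open import Data.Product.Function.NonDependent.Propositional using (_×-⇔_)
open import Data.Sum using (inj₁; inj₂)
open import Data.Unit using (tt)
open import Function using (_∘_; const)
open import Function.Bundles using (_⇔_; mk⇔; Equivalence)
open import Function.Properties.Equivalence using () renaming (trans to ⇔-trans)
open import Relation.Binary.PropositionalEquality
open import Relation.Nullary using (Dec; yes; no; does)
open import Relation.Nullary.Decidable using (T?; dec-true; dec-false)

T-does : ∀ {A : Set} (a? : Dec A) → T (does a?) ⇔ A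
T-does (yes a) = mk⇔ (const a) (const tt)
T-does (no ¬a) = mk⇔ (λ ()) ¬a

interval : ℕ → ℕ → List ℕ
interval a zero    = []
interval a (suc l) = a ∷ interval (suc a) l

select : (ℕ → Bool) → ℕ → ℕ → List ℕ
select p a l = filterᵇ p (interval a l)

length-interval : ∀ a l → length (interval a l) ≡ l
length-interval a zero    = refl
length-interval a (suc l) = cong suc (length-interval (suc a) l)

interval-++ : ∀ a l₁ l₂ → interval a (l₁ + l₂) ≡ interval a l₁ ++ interval (a + l₁) l₂
interval-++ a zero     l₂ rewrite +-identityʳ a = refl
interval-++ a (suc l₁) l₂ rewrite +-suc a l₁ = cong (a ∷_) (interval-++ (suc a) l₁ l₂)

interval⁺ : ∀ {P : ℕ → Set} a l → (∀ {i} → a ≤ i → i < a + l → P i) → All P (interval a l)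
interval⁺     a zero    _ = []
interval⁺ {P} a (suc l) h = h ≤-refl (m<m+n a z<s) ∷ interval⁺ (suc a) l h′
  where
  h′ : ∀ {i} → suc a ≤ i → i < suc a + l → P i
  h′ {i} a<i i<1+a+l = h (<⇒≤ a<i) (subst (i <_) (sym (+-suc a l)) i<1+a+l)

filterᵇ-cong : ∀ {p q : ℕ → Bool} {xs} → All (λ x → p x ≡ q x) xs → filterᵇ p xs ≡ filterᵇ q xs
filterᵇ-cong [] = refl
filterᵇ-cong {p} {q} {x ∷ xs}      (e ∷ es) with p x | q x | e
... | true  | .true  | refl = cong (x ∷_) (filterᵇ-cong es)
... | false | .false | refl = filterᵇ-cong es

select-++ : ∀ p a l₁ l₂ → select p a (l₁ + l₂) ≡ select p a l₁ ++ select p (a + l₁) l₂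
select-++ p a l₁ l₂ =
  trans (cong (filterᵇ p) (interval-++ a l₁ l₂)) (filter-++ (T? ∘ p) (interval a l₁) _)

length-select-++ : ∀ p a l₁ l₂ → length (select p a (l₁ + l₂))
                                 ≡ length (select p a l₁) + length (select p (a + l₁) l₂)
length-select-++ p a l₁ l₂ = trans (cong length (select-++ p a l₁ l₂)) (length-++ (select p a l₁))

length-select-shift : ∀ p k a l →
                      length (select (λ i → p (i + k)) a l) ≡ length (select p (a + k) l)
length-select-shift p k a zero    = refl
length-select-shift p k a (suc l) with p (a + k)
... | true  = cong suc (length-select-shift p k (suc a) l)
... | false = length-select-shift p k (suc a) l

length-select-∧-not : ∀ {p q} → (∀ i → T (q i) → T (p i)) → ∀ a l →
  length (select (λ i → p i ∧ not (q i)) a l) + length (select q a l) ≡ length (select p a l)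
length-select-∧-not         _   _ zero    = refl
length-select-∧-not {p} {q} q⊆p a (suc l) with p a | q a | q⊆p a
... | true  | true  | _   = trans (+-suc _ _) (cong suc (length-select-∧-not q⊆p (suc a) l))
... | true  | false | _   = cong suc (length-select-∧-not q⊆p (suc a) l)
... | false | false | _   = length-select-∧-not q⊆p (suc a) l
... | false | true  | q⊆p = ⊥-elim (q⊆p tt)

select-interval : ∀ p lo hi n → (∀ i → T (p i) ⇔ (lo ≤ i × i < hi)) → lo ≤ hi → hi ≤ n →
                  select p 0 n ≡ interval lo (hi ∸ lo)
select-interval p lo hi n p⇔ lo≤hi hi≤n = begin
  select p 0 n
    ≡⟨ cong (select p 0) n≡lo+m+r ⟩
  select p 0 (lo + (m + r))
    ≡⟨ select-++ p 0 lo (m + r) ⟩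
  select p 0 lo ++ select p lo (m + r)
    ≡⟨ cong (select p 0 lo ++_) (select-++ p lo m r) ⟩
  select p 0 lo ++ (select p lo m ++ select p (lo + m) r)
    ≡⟨ cong₂ (λ xs ys → xs ++ (select p lo m ++ ys)) before after ⟩
  select p lo m ++ []
    ≡⟨ ++-identityʳ _ ⟩
  select p lo m
    ≡⟨ filter-all (T? ∘ p) inside ⟩
  interval lo m ∎
  where
  open ≡-Reasoning
  m r : ℕ
  m = hi ∸ lo
  r = n ∸ hi
  lo+m≡hi : lo + m ≡ hi
  lo+m≡hi = m+[n∸m]≡n lo≤hi
  n≡lo+m+r : n ≡ lo + (m + r)
  n≡lo+m+r = sym (trans (sym (+-assoc lo m r)) (trans (cong (_+ r) lo+m≡hi) (m+[n∸m]≡n hi≤n)))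
  before : select p 0 lo ≡ []
  before = filter-none (T? ∘ p) (interval⁺ 0 lo λ _ i<lo pi →
             <⇒≱ i<lo (proj₁ (Equivalence.to (p⇔ _) pi)))
  inside : All (T ∘ p) (interval lo m)
  inside = interval⁺ lo m λ lo≤i i<lo+m →
             Equivalence.from (p⇔ _) (lo≤i , subst (_ <_) lo+m≡hi i<lo+m)
  after : select p (lo + m) r ≡ []
  after = filter-none (T? ∘ p) (interval⁺ (lo + m) r λ lo+m≤i _ pi →
            <⇒≱ (proj₂ (Equivalence.to (p⇔ _) pi)) (subst (_≤ _) lo+m≡hi lo+m≤i))

data Ascending (lo U : ℕ) : List ℕ → Set where
  []  : Ascending lo U []
  _∷_ : ∀ {x xs} → lo ≤ x × x < U → Ascending (suc x) U xs → Ascending lo U (x ∷ xs)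

Ascending-weaken : ∀ {lo lo′ U xs} → lo ≤ lo′ → Ascending lo′ U xs → Ascending lo U xs
Ascending-weaken _      []                     = []
Ascending-weaken lo≤lo′ ((lo′≤x , x<U) ∷ asc) = (≤-trans lo≤lo′ lo′≤x , x<U) ∷ asc

select-ascending : ∀ {p U} → (∀ i → T (p i) → i < U) → ∀ a l → Ascending a U (select p a l)
select-ascending     _     _ zero    = []
select-ascending {p} bound a (suc l) with p a in pa
... | true  = (≤-refl , bound a (subst T (sym pa) tt)) ∷ select-ascending bound (suc a) l
... | false = Ascending-weaken (n≤1+n a) (select-ascending bound (suc a) l)

ascending-length : ∀ {lo U xs} → Ascending lo U xs → lo ≤ U → lo + length xs ≤ U
ascending-length {lo} {U} []                             lo≤U =
  subst (_≤ U) (sym (+-identityʳ lo)) lo≤U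
ascending-length {lo} {U} {x ∷ xs} ((lo≤x , x<U) ∷ asc) _    =
  subst (_≤ U) (sym (+-suc lo (length xs)))
        (≤-trans (s≤s (+-monoˡ-≤ (length xs) lo≤x)) (ascending-length asc x<U))

ascending-≤-last : ∀ {lo U xs} → Ascending lo U xs →
                   Pointwise _≤_ xs (interval (U ∸ length xs) (length xs))
ascending-≤-last []                                 = []
ascending-≤-last {U = U} {x ∷ xs} ((_ , x<U) ∷ asc) =
  m+n≤o⇒m≤o∸n x x+1+l≤U
    ∷ subst (λ a → Pointwise _≤_ xs (interval a l)) U∸l≡1+U∸[1+l] (ascending-≤-last asc)
  where
  l : ℕ
  l = length xs
  x+1+l≤U : x + suc l ≤ U
  x+1+l≤U = subst (_≤ U) (sym (+-suc x l)) (ascending-length asc x<U)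
  U∸l≡1+U∸[1+l] : U ∸ l ≡ suc (U ∸ suc l)
  U∸l≡1+U∸[1+l] = +-∸-assoc 1 (m+n≤o⇒n≤o x x+1+l≤U)

ascending-≤-interval : ∀ {lo U xs} k → Ascending lo U xs → k ≤ U → length xs ≡ U ∸ k →
                       Pointwise _≤_ xs (interval k (U ∸ k))
ascending-≤-interval {U = U} {xs} k asc k≤U len =
  subst (λ a → Pointwise _≤_ xs (interval a (U ∸ k))) (m∸[m∸n]≡n k≤U)
        (subst (λ l → Pointwise _≤_ xs (interval (U ∸ l) l)) len (ascending-≤-last asc))

-- Columns become predicates on ℕ (false from n on), so that rows can be shifted arithmetically.
extend : ∀ {n} → (Fin n → Bool) → ℕ → Bool
extend {n} f m with m <? n
... | yes m<n = f (fromℕ< m<n)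
... | no  _   = false

extend-toℕ : ∀ {n} (f : Fin n → Bool) i → extend f (toℕ i) ≡ f i
extend-toℕ {n} f i with toℕ i <? n
... | yes i<n = cong f (fromℕ<-toℕ i i<n)
... | no  i≮n = ⊥-elim (i≮n (toℕ<n i))

extend-⊆ : ∀ {n} {f g : Fin n → Bool} → (∀ i → T (f i) → T (g i)) →
           ∀ m → T (extend f m) → T (extend g m)
extend-⊆ {n} f⊆g m with m <? n
... | yes m<n = f⊆g (fromℕ< m<n)
... | no  _   = λ ()

extend-interval : ∀ {n lo hi} {f : Fin n → Bool} → (∀ i → T (f i) ⇔ (lo ≤ toℕ i × toℕ i < hi)) →
                  hi ≤ n → ∀ m → T (extend f m) ⇔ (lo ≤ m × m < hi)
extend-interval {n} {lo} {hi} {f} f⇔ hi≤n m with m <? n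
... | yes m<n =
  subst (λ x → T (f (fromℕ< m<n)) ⇔ (lo ≤ x × x < hi)) (toℕ-fromℕ< m<n) (f⇔ (fromℕ< m<n))
... | no  m≮n = mk⇔ (λ ()) (λ (_ , m<hi) → m≮n (<-≤-trans m<hi hi≤n))

map-filterᵇ : ∀ {A : Set} {f : A → Bool} {p : ℕ → Bool} {h : A → ℕ} → (∀ x → f x ≡ p (h x)) →
              ∀ xs → map h (filterᵇ f xs) ≡ filterᵇ p (map h xs)
map-filterᵇ                 f≡p∘h []       = refl
map-filterᵇ {f = f} {p} {h} f≡p∘h (x ∷ xs) with f x | p (h x) | f≡p∘h x
... | true  | .true  | refl = cong (h x ∷_) (map-filterᵇ f≡p∘h xs)
... | false | .false | refl = map-filterᵇ f≡p∘h xs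

tabulate-+toℕ : ∀ a m → tabulate {n = m} (λ i → a + toℕ i) ≡ interval a m
tabulate-+toℕ a zero    = refl
tabulate-+toℕ a (suc m) =
  cong₂ _∷_ (+-identityʳ a) (trans (tabulate-cong (λ i → +-suc a (toℕ i))) (tabulate-+toℕ (suc a) m))

column-select : ∀ {n} (D : Diagram n) j (p : ℕ → Bool) → (∀ i → D i j ≡ p (toℕ i)) →
                map toℕ (column D j) ≡ select p 0 n
column-select {n} D j p D≡p = begin
  map toℕ (column D j)              ≡⟨ map-filterᵇ D≡p (allFin n) ⟩
  filterᵇ p (map toℕ (allFin n))    ≡⟨ cong (filterᵇ p) (map-tabulate {n = n} (λ i → i) toℕ) ⟩
  filterᵇ p (tabulate {n = n} toℕ)  ≡⟨ cong (filterᵇ p) (tabulate-+toℕ 0 n) ⟩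
  select p 0 n                      ∎
  where open ≡-Reasoning

module Raise (k b : ℕ) (b≤k : b ≤ k) (s d : ℕ → Bool)
             (s⊆d : ∀ m → T (s m) → T (d m)) (d⇒k≤ : ∀ m → T (d m) → k ≤ m) where

  missing : ℕ → Bool
  missing m = d m ∧ not (s m)

  moved : ℕ → Bool
  moved m = does (m <? b) ∧ missing (m + k)

  raised : ℕ → Bool
  raised m = s m ∨ moved m

  moved-≥b : ∀ {m} → b ≤ m → moved m ≡ false
  moved-≥b {m} b≤m = cong (_∧ missing (m + k)) (dec-false (m <? b) (≤⇒≯ b≤m))

  s-<k : ∀ {m} → m < k → s m ≡ false
  s-<k {m} m<k = dec-false (T? (s m)) (λ sm → <⇒≱ m<k (d⇒k≤ m (s⊆d m sm)))

  raised-∧ : ∀ m → raised m ∧ d m ≡ s m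
  raised-∧ m with s m in sm | d m in dm
  ... | true  | true  = refl
  ... | true  | false = ⊥-elim (subst T dm (s⊆d m (subst T (sym sm) tt)))
  ... | false | false = ∧-zeroʳ (moved m)
  ... | false | true  =
    trans (∧-identityʳ (moved m)) (moved-≥b (≤-trans b≤k (d⇒k≤ m (subst T (sym dm) tt))))

  raised-< : ∀ {U} → k ≤ U → (∀ m → T (d m) → m < U) → ∀ m → T (raised m) → m < U
  raised-< k≤U d⇒<U m t with Equivalence.to T-∨ t
  ... | inj₁ sm = d⇒<U m (s⊆d m sm)
  ... | inj₂ mm = <-≤-trans (Equivalence.to (T-does (m <? b)) (proj₁ (Equivalence.to T-∧ mm)))
                            (≤-trans b≤k k≤U)

  length-select-moved : length (select moved 0 k) ≡ length (select missing k b)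
  length-select-moved = begin
    length (select moved 0 k)
      ≡⟨ cong (length ∘ select moved 0) (sym (m+[n∸m]≡n b≤k)) ⟩
    length (select moved 0 (b + (k ∸ b)))
      ≡⟨ length-select-++ moved 0 b (k ∸ b) ⟩
    length (select moved 0 b) + length (select moved b (k ∸ b))
      ≡⟨ cong₂ (λ xs ys → length xs + length ys) moved-below-b moved-above-b ⟩
    length (select (λ i → missing (i + k)) 0 b) + 0
      ≡⟨ +-identityʳ _ ⟩
    length (select (λ i → missing (i + k)) 0 b)
      ≡⟨ length-select-shift missing k 0 b ⟩
    length (select missing k b) ∎
    where
    open ≡-Reasoning
    moved-below-b : select moved 0 b ≡ select (λ i → missing (i + k)) 0 b
    moved-below-b = filterᵇ-cong (interval⁺ 0 b λ {i} _ i<b →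
                      cong (_∧ missing (i + k)) (dec-true (i <? b) i<b))
    moved-above-b : select moved b (k ∸ b) ≡ []
    moved-above-b = filter-none (T? ∘ moved) (interval⁺ b (k ∸ b) λ b≤i _ →
                      subst T (moved-≥b b≤i))

  length-select-raised : length (select raised 0 (k + b)) ≡ length (select d 0 (k + b))
  length-select-raised = begin
    length (select raised 0 (k + b))
      ≡⟨ length-select-++ raised 0 k b ⟩
    length (select raised 0 k) + length (select raised k b)
      ≡⟨ cong₂ (λ xs ys → length xs + length ys) raised-below-k raised-above-k ⟩
    length (select moved 0 k) + length (select s k b)
      ≡⟨ cong (_+ length (select s k b)) length-select-moved ⟩
    length (select missing k b) + length (select s k b)
      ≡⟨ length-select-∧-not s⊆d k b ⟩
    length (select d k b)
      ≡⟨ cong (λ xs → length xs + length (select d k b)) d-below-k ⟨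
    length (select d 0 k) + length (select d k b)
      ≡⟨ length-select-++ d 0 k b ⟨
    length (select d 0 (k + b)) ∎
    where
    open ≡-Reasoning
    raised-below-k : select raised 0 k ≡ select moved 0 k
    raised-below-k = filterᵇ-cong (interval⁺ 0 k λ {i} _ i<k → cong (_∨ moved i) (s-<k i<k))
    raised-above-k : select raised k b ≡ select s k b
    raised-above-k = filterᵇ-cong (interval⁺ k b λ {i} k≤i _ →
                       trans (cong (s i ∨_) (moved-≥b (≤-trans b≤k k≤i))) (∨-identityʳ (s i)))
    d-below-k : select d 0 k ≡ []
    d-below-k = filter-none (T? ∘ d) (interval⁺ 0 k λ _ i<k di → <⇒≱ i<k (d⇒k≤ _ di))

∩-Surjective : ∀ {n} → Diagram n → Set
∩-Surjective {n} D = (S : Diagram n) → S ⊆ᴰ D → Σ (Diagram n) (λ C → (C ≤ᴰ D) × ((C ∩ᴰ D) ≡ᴰ S))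

module IntervalColumns (k b : ℕ) (b≤k : b ≤ k) (D : Diagram (k + b)) (U : Fin (k + b) → ℕ)
                       (k≤U : ∀ j → k ≤ U j) (U≤n : ∀ j → U j ≤ k + b)
                       (D∋⇔ : ∀ i j → D ∋ (i , j) ⇔ (k ≤ toℕ i × toℕ i < U j))
                       (S : Diagram (k + b)) (S⊆D : S ⊆ᴰ D) where

  n : ℕ
  n = k + b

  D-column : Fin n → ℕ → Bool
  D-column j = extend (λ i → D i j)

  D-column⇔ : ∀ j m → T (D-column j m) ⇔ (k ≤ m × m < U j)
  D-column⇔ j = extend-interval (λ i → D∋⇔ i j) (U≤n j)

  select-D-column : ∀ j → select (D-column j) 0 n ≡ interval k (U j ∸ k)
  select-D-column j = select-interval (D-column j) k (U j) n (D-column⇔ j) (k≤U j) (U≤n j)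

  module Column (j : Fin n) = Raise k b b≤k (extend (λ i → S i j)) (D-column j)
    (extend-⊆ (λ i → S⊆D i j)) (λ m → proj₁ ∘ Equivalence.to (D-column⇔ j m))
  open Column using (raised; raised-∧; raised-<; length-select-raised)

  C : Diagram n
  C i j = raised j (toℕ i)

  length-raised-column : ∀ j → length (select (raised j) 0 n) ≡ U j ∸ k
  length-raised-column j = begin
    length (select (raised j) 0 n)     ≡⟨ length-select-raised j ⟩
    length (select (D-column j) 0 n)   ≡⟨ cong length (select-D-column j) ⟩
    length (interval k (U j ∸ k))      ≡⟨ length-interval k (U j ∸ k) ⟩
    U j ∸ k                            ∎
    where open ≡-Reasoning

  C≤D : C ≤ᴰ D
  C≤D j = map⁻ toℕ toℕ (subst₂ (Pointwise _≤_) (sym column-C) (sym column-D)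
    (ascending-≤-interval k (select-ascending below-U 0 n) (k≤U j) (length-raised-column j)))
    where
    column-C : map toℕ (column C j) ≡ select (raised j) 0 n
    column-C = column-select C j (raised j) (λ _ → refl)
    column-D : map toℕ (column D j) ≡ interval k (U j ∸ k)
    column-D = trans (column-select D j (D-column j) (λ i → sym (extend-toℕ _ i))) (select-D-column j)
    below-U : ∀ m → T (raised j m) → m < U j
    below-U = raised-< j (k≤U j) (λ m → proj₂ ∘ Equivalence.to (D-column⇔ j m))

  C∩D≡S : (C ∩ᴰ D) ≡ᴰ S
  C∩D≡S i j = begin
    raised j (toℕ i) ∧ D i j
      ≡⟨ cong (raised j (toℕ i) ∧_) (extend-toℕ (λ r → D r j) i) ⟨
    raised j (toℕ i) ∧ D-column j (toℕ i)
      ≡⟨ raised-∧ j (toℕ i) ⟩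
    extend (λ r → S r j) (toℕ i)
      ≡⟨ extend-toℕ (λ r → S r j) i ⟩
    S i j ∎
    where open ≡-Reasoning

intervalColumns-∩-surjective : ∀ {n} k b → b ≤ k → k + b ≡ n → (D : Diagram n) (U : Fin n → ℕ) →
  (∀ j → k ≤ U j) → (∀ j → U j ≤ n) → (∀ i j → D ∋ (i , j) ⇔ (k ≤ toℕ i × toℕ i < U j)) →
  ∩-Surjective D
intervalColumns-∩-surjective k b b≤k refl D U k≤U U≤n D∋⇔ S S⊆D = C , C≤D , C∩D≡S
  where open IntervalColumns k b b≤k D U k≤U U≤n D∋⇔ S S⊆D

rothe-∋ : ∀ {n} (w : Permutation′ n) i j →
          rothe w ∋ (i , j) ⇔ (toℕ i < toℕ (w ⟨$⟩ˡ j) × toℕ j < toℕ (w ⟨$⟩ʳ i))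
rothe-∋ w i j =
  ⇔-trans T-∧ (T-does (toℕ i <? toℕ (w ⟨$⟩ˡ j)) ×-⇔ T-does (toℕ j <? toℕ (w ⟨$⟩ʳ i)))

m<o∸[1+n]⇒n<o∸[1+m] : ∀ {m n o} → n < o → m < o ∸ suc n → n < o ∸ suc m
m<o∸[1+n]⇒n<o∸[1+m] {m} {n} {o} n<o m<o∸[1+n] =
  m+n≤o⇒m≤o∸n (suc n) (subst (_≤ o) (+-comm (suc m) (suc n)) (m≤o∸n⇒m+n≤o (suc m) n<o m<o∸[1+n]))

layeredEnd : ℕ → ℕ → ℕ → ℕ
layeredEnd k n j with j <? k
... | yes _ = k
... | no  _ = k + (n ∸ suc j)

k≤layeredEnd : ∀ k n j → k ≤ layeredEnd k n j
k≤layeredEnd k n j with j <? k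
... | yes _ = ≤-refl
... | no  _ = m≤m+n k (n ∸ suc j)

layeredEnd≤n : ∀ {k n j} → k ≤ n → j < n → layeredEnd k n j ≤ n
layeredEnd≤n {k} {n} {j} k≤n j<n with j <? k
... | yes _   = k≤n
... | no  j≮k = ≤-trans (+-monoˡ-≤ (n ∸ suc j) (≤-trans (≮⇒≥ j≮k) (n≤1+n j)))
                        (≤-reflexive (m+[n∸m]≡n j<n))

wℕ-rothe : ∀ k n i j → i < n → j < n →
           (i < wℕ k n j × j < wℕ k n i) ⇔ (k ≤ i × i < layeredEnd k n j)
wℕ-rothe k n i j i<n j<n with j <? k | i <? k
... | yes j<k | yes i<k = mk⇔ (λ (i<j , j<i) → ⊥-elim (<-asym i<j j<i))
                              (λ (k≤i , _) → ⊥-elim (<⇒≱ i<k k≤i))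
... | yes j<k | no  i≮k = mk⇔ (λ (i<j , _) → ⊥-elim (i≮k (<-trans i<j j<k)))
                              (λ (_ , i<k) → ⊥-elim (i≮k i<k))
... | no  j≮k | yes i<k = mk⇔ (λ (_ , j<i) → ⊥-elim (j≮k (<-trans j<i i<k)))
                              (λ (k≤i , _) → ⊥-elim (<⇒≱ i<k k≤i))
... | no  j≮k | no  i≮k = mk⇔ (λ (i<wj , _) → ≮⇒≥ i≮k , i<wj) (λ (_ , i<wj) → i<wj , j<wi i<wj)
  where
  j<wi : i < k + (n ∸ suc j) → j < k + (n ∸ suc i)
  j<wi i<wj = subst (j <_) (+-∸-assoc k i<n)
    (m<o∸[1+n]⇒n<o∸[1+m] (≤-trans j<n (m≤n+m n k)) (subst (i <_) (sym (+-∸-assoc k j<n)) i<wj))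

layered-rothe-∋ : ∀ n b (i j : Fin n) →
  rothe (layered n b) ∋ (i , j) ⇔ (n ∸ b ≤ toℕ i × toℕ i < layeredEnd (n ∸ b) n (toℕ j))
layered-rothe-∋ n b i j =
  ⇔-trans (rothe-∋ (layered n b) i j) (at-wℕ (toℕ-fromℕ< _) (toℕ-fromℕ< _))
  where
  at-wℕ : ∀ {wj wi} → wj ≡ wℕ (n ∸ b) n (toℕ j) → wi ≡ wℕ (n ∸ b) n (toℕ i) →
          (toℕ i < wj × toℕ j < wi) ⇔ (n ∸ b ≤ toℕ i × toℕ i < layeredEnd (n ∸ b) n (toℕ j))
  at-wℕ refl refl = wℕ-rothe (n ∸ b) n (toℕ i) (toℕ j) (toℕ<n i) (toℕ<n j)

lemma3p2 : (n b : ℕ) → 1 ≤ n → 1 ≤ b → 2 * b ≤ n →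
           (S : Diagram n) → S ⊆ᴰ rothe (layered n b) →
           Σ (Diagram n) (λ C → (C ≤ᴰ rothe (layered n b)) × ((C ∩ᴰ rothe (layered n b)) ≡ᴰ S))
lemma3p2 n b _ _ 2b≤n =
  intervalColumns-∩-surjective (n ∸ b) b b≤n∸b (m∸n+n≡m b≤n) (rothe (layered n b))
    (λ j → layeredEnd (n ∸ b) n (toℕ j)) (λ j → k≤layeredEnd (n ∸ b) n (toℕ j))
    (λ j → layeredEnd≤n (m∸n≤m n b) (toℕ<n j)) (layered-rothe-∋ n b)
  where
  b+b≤n : b + b ≤ n
  b+b≤n = subst (λ x → b + x ≤ n) (+-identityʳ b) 2b≤n
  b≤n∸b : b ≤ n ∸ b
  b≤n∸b = m+n≤o⇒m≤o∸n b b+b≤n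
  b≤n : b ≤ n
  b≤n = m+n≤o⇒n≤o b b+b≤n
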